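{- Let $X$ and $Y$ be directed separations in a digraph $G$. Let $T:=X^+\cap Y^+$, $B:=X^-\cap Y^-$, $\bar T:=X^-\cup Y^-$ and $\bar B:=X^+\cup Y^+$ (unions and intersections of subgraphs). Let $S_t:=(\operatorname{sep}(X)\cup\operatorname{sep}(Y))\cap V(T)$ and $S_l:=(\operatorname{sep}(X)\cup\operatorname{sep}(Y))\cap V(B)$. Then $(T,\bar T)$ and $(B,\bar B)$ are directed separations with separators $S_t$ and $S_l$ respectively, each of which is uncrossed with $X$ and with $Y$. Furthermore $|S_l|+|S_t|=|\operatorname{sep}(X)|+|\operatorname{sep}(Y)|$, and thus $\min\{|S_l|,|S_t|\}\le\max\{|\operatorname{sep}(X)|,|\operatorname{sep}(Y)|\}$. In particular, if $|\operatorname{sep}(X)|=|\operatorname{sep}(Y)|=k$, then at least one of $S_l,S_t$ has size at most $k$.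
   Context: A directed separation of a digraph $G$ is a pair $(A,B)$ of subgraphs with $V(A)\cup V(B)=V(G)$ such that either no edge has tail in $V(A)\setminus V(B)$ and head in $V(B)\setminus V(A)$, or no edge has tail in $V(B)\setminus V(A)$ and head in $V(A)\setminus V(B)$. Its separator is $\operatorname{sep}(A,B)=V(A)\cap V(B)$ and its order is $|\operatorname{sep}(A,B)|$. For a directed separation $X$, $X^+$ and $X^-$ denote its two sides labelled so that $X=(X^+,X^-)$ and no edge has tail in $V(X^-)\setminus V(X^+)$ and head in $V(X^+)\setminus V(X^-)$ (if there are no edges between the two sides outside the separator in either direction, the labelling is arbitrary). Two separations $X=(A,B)$ and $Y=(A',B')$ are uncrossed if $A'\subseteq A$ and $B\subseteq B'$, or $A'\subseteq B$ and $A\subseteq B'$. -}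

module Defs where

open import Data.Nat using (ℕ)
open import Data.Fin using (Fin)
open import Data.Fin.Subset using (Subset; _∈_; _∉_; _⊆_; _∩_; _∪_; ⊤)
open import Data.Fin.Subset.Properties using (x∈p∩q⁺; x∈p∩q⁻; x∈p∪q⁻; x∈p∪q⁺)
open import Data.Product using (_×_; _,_; proj₁; proj₂)
open import Data.Sum using (_⊎_; inj₁; inj₂)
open import Data.Empty using (⊥)
open import Relation.Binary.PropositionalEquality using (_≡_)

record Digraph : Set where
  field
    n    : ℕ
    m    : ℕ
    tail : Fin m → Fin n
    head : Fin m → Fin n
open Digraph public

Vtx : Digraph → Set
Vtx G = Fin (n G)

record Subgraph (G : Digraph) : Set where
  constructor subgraph
  field
    V      : Subset (n G)
    E      : Subset (m G)
    closed : ∀ e → e ∈ E → (tail G e ∈ V) × (head G e ∈ V)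
open Subgraph public

module _ {G : Digraph} where

  _⊑_ : Subgraph G → Subgraph G → Set
  A ⊑ B = (V A ⊆ V B) × (E A ⊆ E B)

  _∩ᵍ_ : Subgraph G → Subgraph G → Subgraph G
  A ∩ᵍ B = subgraph (V A ∩ V B) (E A ∩ E B) cl
    where
    cl : ∀ e → e ∈ E A ∩ E B → (tail G e ∈ V A ∩ V B) × (head G e ∈ V A ∩ V B)
    cl e e∈ with x∈p∩q⁻ (E A) (E B) e∈
    ... | eA , eB =
      x∈p∩q⁺ (proj₁ (closed A e eA) , proj₁ (closed B e eB)) ,
      x∈p∩q⁺ (proj₂ (closed A e eA) , proj₂ (closed B e eB))

  _∪ᵍ_ : Subgraph G → Subgraph G → Subgraph G
  A ∪ᵍ B = subgraph (V A ∪ V B) (E A ∪ E B) cl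
    where
    cl : ∀ e → e ∈ E A ∪ E B → (tail G e ∈ V A ∪ V B) × (head G e ∈ V A ∪ V B)
    cl e e∈ with x∈p∪q⁻ (E A) (E B) e∈
    ... | inj₁ eA = x∈p∪q⁺ (inj₁ (proj₁ (closed A e eA))) , x∈p∪q⁺ (inj₁ (proj₂ (closed A e eA)))
    ... | inj₂ eB = x∈p∪q⁺ (inj₂ (proj₁ (closed B e eB))) , x∈p∪q⁺ (inj₂ (proj₂ (closed B e eB)))

  NoEdgeFromTo : Subgraph G → Subgraph G → Set
  NoEdgeFromTo A B = ∀ e → tail G e ∈ V A → tail G e ∉ V B
                         → head G e ∈ V B → head G e ∉ V A → ⊥

  IsDirSep : Subgraph G → Subgraph G → Set
  IsDirSep A B = (V A ∪ V B ≡ ⊤) × (NoEdgeFromTo A B ⊎ NoEdgeFromTo B A)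

  -- (A , B) is a directed separation labelled as (X⁺ , X⁻):
  -- no edge with tail in V(X⁻) \ V(X⁺) and head in V(X⁺) \ V(X⁻)
  IsOrientedDirSep : Subgraph G → Subgraph G → Set
  IsOrientedDirSep A B = (V A ∪ V B ≡ ⊤) × NoEdgeFromTo B A

  sep : Subgraph G → Subgraph G → Subset (n G)
  sep A B = V A ∩ V B

  Uncrossed : Subgraph G → Subgraph G → Subgraph G → Subgraph G → Set
  Uncrossed A B A' B' = (A' ⊑ A × B ⊑ B') ⊎ (A' ⊑ B × A ⊑ B')

{-# OPTIONS --safe #-}
-- Because V(X⁺) ∪ V(X⁻) is everything, X is a directed separation oriented as (X⁺ , X⁻)
-- exactly when every edge has its tail in X⁺ or its head in X⁻. This property is
-- inherited by (X⁺ ∩ Y⁺ , X⁻ ∪ Y⁻) and by (X⁺ ∪ Y⁺ , X⁻ ∩ Y⁻), so both are directed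
-- separations. Their separators St and Sl together cover sep X ∪ sep Y (a vertex of
-- sep X lies in Y⁺ or in Y⁻) and meet in sep X ∩ sep Y, so inclusion–exclusion gives
-- ∣Sl∣ + ∣St∣ = ∣sep X∣ + ∣sep Y∣, and the bound on the minimum follows.
module Submission where

open import Defs
open import Data.Nat using (ℕ; suc; _+_; _≤_; _⊓_; _⊔_)
open import Data.Nat.Properties
  using (+-suc; ⊓-sel; ⊔-idem; ≮⇒≥; <-irrefl; +-mono-<; ≤-<-trans; <-≤-trans; m≤m⊔n; m≤n⊔m; m⊓n≤m; m⊓n≤n; ≤-trans; ≤-reflexive)
open import Data.Fin using (Fin)
open import Data.Fin.Subset using (Subset; inside; outside; _∈_; _∉_; _⊆_; _∩_; _∪_; ⊤; ∣_∣)
open import Data.Fin.Subset.Properties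
  using (x∈p∩q⁺; x∈p∩q⁻; x∈p∪q⁺; x∈p∪q⁻; ∈⊤; ⊆⊤; ⊆-antisym; p∩q⊆p; p∩q⊆q; p⊆p∪q; q⊆p∪q; ∩-comm; ∪-comm; ∩-distribˡ-∪; _∈?_)
open import Data.Vec using ([]; _∷_)
open import Data.Product using (_×_; _,_; proj₁)
open import Data.Sum using (_⊎_; inj₁; inj₂; [_,_]′; swap)
open import Data.Empty using (⊥-elim)
open import Relation.Nullary using (yes; no)
open import Relation.Binary.PropositionalEquality using (_≡_; refl; sym; trans; cong; cong₂; subst; module ≡-Reasoning)

private variable
  k : ℕ
  x : Fin k
  p q r s : Subset k

∣p∪q∣+∣p∩q∣≡∣p∣+∣q∣ : (p q : Subset k) → ∣ p ∪ q ∣ + ∣ p ∩ q ∣ ≡ ∣ p ∣ + ∣ q ∣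
∣p∪q∣+∣p∩q∣≡∣p∣+∣q∣ []            []            = refl
∣p∪q∣+∣p∩q∣≡∣p∣+∣q∣ (inside  ∷ p) (inside  ∷ q) =
  cong suc (trans (+-suc _ _) (trans (cong suc (∣p∪q∣+∣p∩q∣≡∣p∣+∣q∣ p q)) (sym (+-suc _ _))))
∣p∪q∣+∣p∩q∣≡∣p∣+∣q∣ (inside  ∷ p) (outside ∷ q) = cong suc (∣p∪q∣+∣p∩q∣≡∣p∣+∣q∣ p q)
∣p∪q∣+∣p∩q∣≡∣p∣+∣q∣ (outside ∷ p) (inside  ∷ q) =
  trans (cong suc (∣p∪q∣+∣p∩q∣≡∣p∣+∣q∣ p q)) (sym (+-suc _ _))
∣p∪q∣+∣p∩q∣≡∣p∣+∣q∣ (outside ∷ p) (outside ∷ q) = ∣p∪q∣+∣p∩q∣≡∣p∣+∣q∣ p q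

p∪q≡⊤⇒x∈p⊎x∈q : p ∪ q ≡ ⊤ → (x : Fin k) → x ∈ p ⊎ x ∈ q
p∪q≡⊤⇒x∈p⊎x∈q {p = p} {q} p∪q≡⊤ x = x∈p∪q⁻ p q (subst (x ∈_) (sym p∪q≡⊤) ∈⊤)

p∪q≡⊤⇒x∉p⇒x∈q : p ∪ q ≡ ⊤ → x ∉ p → x ∈ q
p∪q≡⊤⇒x∉p⇒x∈q p∪q≡⊤ x∉p = [ (λ x∈p → ⊥-elim (x∉p x∈p)) , (λ x∈q → x∈q) ]′ (p∪q≡⊤⇒x∈p⊎x∈q p∪q≡⊤ _)

p∪q≡⊤⇒x∉q⇒x∈p : p ∪ q ≡ ⊤ → x ∉ q → x ∈ p
p∪q≡⊤⇒x∉q⇒x∈p p∪q≡⊤ x∉q = [ (λ x∈p → x∈p) , (λ x∈q → ⊥-elim (x∉q x∈q)) ]′ (p∪q≡⊤⇒x∈p⊎x∈q p∪q≡⊤ _)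

∀x∈p⇒p≡⊤ : ((x : Fin k) → x ∈ p) → p ≡ ⊤
∀x∈p⇒p≡⊤ x∈p = ⊆-antisym ⊆⊤ (λ {x} _ → x∈p x)

p⊆q⇒p∩q≡p : p ⊆ q → p ∩ q ≡ p
p⊆q⇒p∩q≡p {p = p} {q} p⊆q = ⊆-antisym (p∩q⊆p p q) (λ x∈p → x∈p∩q⁺ (x∈p , p⊆q x∈p))

p⊆q∪r⇒p∩q∪p∩r≡p : p ⊆ q ∪ r → (p ∩ q) ∪ (p ∩ r) ≡ p
p⊆q∪r⇒p∩q∪p∩r≡p {p = p} {q} {r} p⊆q∪r = trans (sym (∩-distribˡ-∪ p q r)) (p⊆q⇒p∩q≡p p⊆q∪r)

∩∪-covers : p ∪ q ≡ ⊤ → r ∪ s ≡ ⊤ → (p ∩ r) ∪ (q ∪ s) ≡ ⊤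
∩∪-covers p∪q≡⊤ r∪s≡⊤ = ∀x∈p⇒p≡⊤ λ x →
  [ (λ x∈p → [ (λ x∈r → x∈p∪q⁺ (inj₁ (x∈p∩q⁺ (x∈p , x∈r))))
             , (λ x∈s → x∈p∪q⁺ (inj₂ (x∈p∪q⁺ (inj₂ x∈s)))) ]′ (p∪q≡⊤⇒x∈p⊎x∈q r∪s≡⊤ x))
  , (λ x∈q → x∈p∪q⁺ (inj₂ (x∈p∪q⁺ (inj₁ x∈q)))) ]′ (p∪q≡⊤⇒x∈p⊎x∈q p∪q≡⊤ x)

∪∩-covers : p ∪ q ≡ ⊤ → r ∪ s ≡ ⊤ → (p ∪ r) ∪ (q ∩ s) ≡ ⊤
∪∩-covers {p = p} {q} {r} {s} p∪q≡⊤ r∪s≡⊤ =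
  trans (∪-comm (p ∪ r) (q ∩ s)) (∩∪-covers (trans (∪-comm q p) p∪q≡⊤) (trans (∪-comm s r) r∪s≡⊤))

module _ (p q r s : Subset k) where

  private
    S : Subset k
    S = (p ∩ q) ∪ (r ∩ s)

  covers⇒S⊆q∩s∪p∩r : p ∪ q ≡ ⊤ → r ∪ s ≡ ⊤ → S ⊆ (q ∩ s) ∪ (p ∩ r)
  covers⇒S⊆q∩s∪p∩r p∪q≡⊤ r∪s≡⊤ {x} x∈S with x∈p∪q⁻ (p ∩ q) (r ∩ s) x∈S
  ... | inj₁ x∈p∩q with x∈p∩q⁻ p q x∈p∩q | p∪q≡⊤⇒x∈p⊎x∈q r∪s≡⊤ x
  ...   | x∈p , _   | inj₁ x∈r = x∈p∪q⁺ (inj₂ (x∈p∩q⁺ (x∈p , x∈r)))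
  ...   | _   , x∈q | inj₂ x∈s = x∈p∪q⁺ (inj₁ (x∈p∩q⁺ (x∈q , x∈s)))
  covers⇒S⊆q∩s∪p∩r p∪q≡⊤ r∪s≡⊤ {x} x∈S
      | inj₂ x∈r∩s with x∈p∩q⁻ r s x∈r∩s | p∪q≡⊤⇒x∈p⊎x∈q p∪q≡⊤ x
  ...   | x∈r , _   | inj₁ x∈p = x∈p∪q⁺ (inj₂ (x∈p∩q⁺ (x∈p , x∈r)))
  ...   | _   , x∈s | inj₂ x∈q = x∈p∪q⁺ (inj₁ (x∈p∩q⁺ (x∈q , x∈s)))

  S∩q∩s∩S∩p∩r≡p∩q∩r∩s : (S ∩ (q ∩ s)) ∩ (S ∩ (p ∩ r)) ≡ (p ∩ q) ∩ (r ∩ s)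
  S∩q∩s∩S∩p∩r≡p∩q∩r∩s = ⊆-antisym lhs⊆rhs rhs⊆lhs
    where
    lhs⊆rhs : (S ∩ (q ∩ s)) ∩ (S ∩ (p ∩ r)) ⊆ (p ∩ q) ∩ (r ∩ s)
    lhs⊆rhs x∈ with x∈p∩q⁻ (S ∩ (q ∩ s)) (S ∩ (p ∩ r)) x∈
    ... | x∈Sqs , x∈Spr with x∈p∩q⁻ q s (p∩q⊆q S _ x∈Sqs) | x∈p∩q⁻ p r (p∩q⊆q S _ x∈Spr)
    ... | x∈q , x∈s | x∈p , x∈r = x∈p∩q⁺ (x∈p∩q⁺ (x∈p , x∈q) , x∈p∩q⁺ (x∈r , x∈s))
    rhs⊆lhs : (p ∩ q) ∩ (r ∩ s) ⊆ (S ∩ (q ∩ s)) ∩ (S ∩ (p ∩ r))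
    rhs⊆lhs x∈ with x∈p∩q⁻ (p ∩ q) (r ∩ s) x∈
    ... | x∈pq , x∈rs with x∈p∩q⁻ p q x∈pq | x∈p∩q⁻ r s x∈rs
    ... | x∈p , x∈q | x∈r , x∈s =
      x∈p∩q⁺ ( x∈p∩q⁺ (x∈S , x∈p∩q⁺ (x∈q , x∈s)) , x∈p∩q⁺ (x∈S , x∈p∩q⁺ (x∈p , x∈r)))
      where x∈S = x∈p∪q⁺ (inj₁ x∈pq)

  ∣S∩q∩s∣+∣S∩p∩r∣≡∣p∩q∣+∣r∩s∣ : p ∪ q ≡ ⊤ → r ∪ s ≡ ⊤
    → ∣ S ∩ (q ∩ s) ∣ + ∣ S ∩ (p ∩ r) ∣ ≡ ∣ p ∩ q ∣ + ∣ r ∩ s ∣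
  ∣S∩q∩s∣+∣S∩p∩r∣≡∣p∩q∣+∣r∩s∣ p∪q≡⊤ r∪s≡⊤ = begin
    ∣ S ∩ (q ∩ s) ∣ + ∣ S ∩ (p ∩ r) ∣
      ≡⟨ sym (∣p∪q∣+∣p∩q∣≡∣p∣+∣q∣ (S ∩ (q ∩ s)) (S ∩ (p ∩ r))) ⟩
    ∣ (S ∩ (q ∩ s)) ∪ (S ∩ (p ∩ r)) ∣ + ∣ (S ∩ (q ∩ s)) ∩ (S ∩ (p ∩ r)) ∣
      ≡⟨ cong₂ _+_ (cong ∣_∣ (p⊆q∪r⇒p∩q∪p∩r≡p (covers⇒S⊆q∩s∪p∩r p∪q≡⊤ r∪s≡⊤)))
                   (cong ∣_∣ S∩q∩s∩S∩p∩r≡p∩q∩r∩s) ⟩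
    ∣ S ∣ + ∣ (p ∩ q) ∩ (r ∩ s) ∣
      ≡⟨ ∣p∪q∣+∣p∩q∣≡∣p∣+∣q∣ (p ∩ q) (r ∩ s) ⟩
    ∣ p ∩ q ∣ + ∣ r ∩ s ∣ ∎
    where open ≡-Reasoning

m+n≡o+p⇒m⊓n≤o⊔p : ∀ m n o p → m + n ≡ o + p → m ⊓ n ≤ o ⊔ p
m+n≡o+p⇒m⊓n≤o⊔p m n o p eq = ≮⇒≥ λ o⊔p<m⊓n →
  <-irrefl (sym eq)
    (+-mono-< (<-≤-trans (≤-<-trans (m≤m⊔n o p) o⊔p<m⊓n) (m⊓n≤m m n))
              (<-≤-trans (≤-<-trans (m≤n⊔m o p) o⊔p<m⊓n) (m⊓n≤n m n)))

m⊓n≤o⇒m≤o⊎n≤o : ∀ m n {o} → m ⊓ n ≤ o → m ≤ o ⊎ n ≤ o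
m⊓n≤o⇒m≤o⊎n≤o m n m⊓n≤o with ⊓-sel m n
... | inj₁ m⊓n≡m = inj₁ (subst (_≤ _) m⊓n≡m m⊓n≤o)
... | inj₂ m⊓n≡n = inj₂ (subst (_≤ _) m⊓n≡n m⊓n≤o)

module _ {G : Digraph} where

  A∩ᵍB⊑A : (A B : Subgraph G) → (A ∩ᵍ B) ⊑ A
  A∩ᵍB⊑A A B = p∩q⊆p (V A) (V B) , p∩q⊆p (E A) (E B)

  A∩ᵍB⊑B : (A B : Subgraph G) → (A ∩ᵍ B) ⊑ B
  A∩ᵍB⊑B A B = p∩q⊆q (V A) (V B) , p∩q⊆q (E A) (E B)

  A⊑A∪ᵍB : (A B : Subgraph G) → A ⊑ (A ∪ᵍ B)
  A⊑A∪ᵍB A B = p⊆p∪q (V B) , p⊆p∪q (E B)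

  B⊑A∪ᵍB : (A B : Subgraph G) → B ⊑ (A ∪ᵍ B)
  B⊑A∪ᵍB A B = q⊆p∪q (V A) (V B) , q⊆p∪q (E A) (E B)

  sep-comm : (A B : Subgraph G) → sep A B ≡ sep B A
  sep-comm A B = ∩-comm (V A) (V B)

  sep-∩ᵍ-∪ᵍ : (A B C D : Subgraph G) → sep (A ∩ᵍ C) (B ∪ᵍ D) ≡ (sep A B ∪ sep C D) ∩ V (A ∩ᵍ C)
  sep-∩ᵍ-∪ᵍ A B C D = ⊆-antisym lhs⊆rhs rhs⊆lhs
    where
    lhs⊆rhs : sep (A ∩ᵍ C) (B ∪ᵍ D) ⊆ (sep A B ∪ sep C D) ∩ V (A ∩ᵍ C)
    lhs⊆rhs x∈ with x∈p∩q⁻ (V (A ∩ᵍ C)) (V (B ∪ᵍ D)) x∈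
    ... | x∈AC , x∈BD with x∈p∩q⁻ (V A) (V C) x∈AC | x∈p∪q⁻ (V B) (V D) x∈BD
    ... | x∈A , _   | inj₁ x∈B = x∈p∩q⁺ (x∈p∪q⁺ (inj₁ (x∈p∩q⁺ (x∈A , x∈B))) , x∈AC)
    ... | _   , x∈C | inj₂ x∈D = x∈p∩q⁺ (x∈p∪q⁺ (inj₂ (x∈p∩q⁺ (x∈C , x∈D))) , x∈AC)
    rhs⊆lhs : (sep A B ∪ sep C D) ∩ V (A ∩ᵍ C) ⊆ sep (A ∩ᵍ C) (B ∪ᵍ D)
    rhs⊆lhs x∈ with x∈p∩q⁻ (sep A B ∪ sep C D) (V (A ∩ᵍ C)) x∈
    ... | x∈S , x∈AC with x∈p∪q⁻ (sep A B) (sep C D) x∈S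
    ... | inj₁ x∈AB = x∈p∩q⁺ (x∈AC , x∈p∪q⁺ (inj₁ (p∩q⊆q (V A) (V B) x∈AB)))
    ... | inj₂ x∈CD = x∈p∩q⁺ (x∈AC , x∈p∪q⁺ (inj₂ (p∩q⊆q (V C) (V D) x∈CD)))

  TailIn⊎HeadIn : Subgraph G → Subgraph G → Set
  TailIn⊎HeadIn A B = ∀ e → tail G e ∈ V A ⊎ head G e ∈ V B

  oriented⇒tailIn⊎headIn : (A B : Subgraph G) → IsOrientedDirSep A B → TailIn⊎HeadIn A B
  oriented⇒tailIn⊎headIn A B (cover , noEdge) e with tail G e ∈? V A | head G e ∈? V B
  ... | yes t∈A | _       = inj₁ t∈A
  ... | no _    | yes h∈B = inj₂ h∈B
  ... | no t∉A  | no h∉B  =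
    ⊥-elim (noEdge e (p∪q≡⊤⇒x∉p⇒x∈q cover t∉A) t∉A (p∪q≡⊤⇒x∉q⇒x∈p cover h∉B) h∉B)

  tailIn⊎headIn⇒noEdge : (A B : Subgraph G) → TailIn⊎HeadIn A B → NoEdgeFromTo B A
  tailIn⊎headIn⇒noEdge A B tailIn⊎headIn e _ t∉A _ h∉B = [ t∉A , h∉B ]′ (tailIn⊎headIn e)

  tailIn⊎headIn-∩ᵍ-∪ᵍ : (A B C D : Subgraph G) → TailIn⊎HeadIn A B → TailIn⊎HeadIn C D → TailIn⊎HeadIn (A ∩ᵍ C) (B ∪ᵍ D)
  tailIn⊎headIn-∩ᵍ-∪ᵍ A B C D AB CD e with AB e | CD e
  ... | inj₁ t∈A | inj₁ t∈C = inj₁ (x∈p∩q⁺ (t∈A , t∈C))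
  ... | inj₂ h∈B | _        = inj₂ (x∈p∪q⁺ (inj₁ h∈B))
  ... | _        | inj₂ h∈D = inj₂ (x∈p∪q⁺ (inj₂ h∈D))

  tailIn⊎headIn-∪ᵍ-∩ᵍ : (A B C D : Subgraph G) → TailIn⊎HeadIn A B → TailIn⊎HeadIn C D → TailIn⊎HeadIn (A ∪ᵍ C) (B ∩ᵍ D)
  tailIn⊎headIn-∪ᵍ-∩ᵍ A B C D AB CD e with AB e | CD e
  ... | inj₁ t∈A | _        = inj₁ (x∈p∪q⁺ (inj₁ t∈A))
  ... | _        | inj₁ t∈C = inj₁ (x∈p∪q⁺ (inj₂ t∈C))
  ... | inj₂ h∈B | inj₂ h∈D = inj₂ (x∈p∩q⁺ (h∈B , h∈D))

  oriented-∩ᵍ-∪ᵍ : (A B C D : Subgraph G)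
    → IsOrientedDirSep A B → IsOrientedDirSep C D → IsOrientedDirSep (A ∩ᵍ C) (B ∪ᵍ D)
  oriented-∩ᵍ-∪ᵍ A B C D AB CD =
    ∩∪-covers (proj₁ AB) (proj₁ CD) ,
    tailIn⊎headIn⇒noEdge (A ∩ᵍ C) (B ∪ᵍ D)
      (tailIn⊎headIn-∩ᵍ-∪ᵍ A B C D (oriented⇒tailIn⊎headIn A B AB) (oriented⇒tailIn⊎headIn C D CD))

  oriented-∪ᵍ-∩ᵍ : (A B C D : Subgraph G)
    → IsOrientedDirSep A B → IsOrientedDirSep C D → IsOrientedDirSep (A ∪ᵍ C) (B ∩ᵍ D)
  oriented-∪ᵍ-∩ᵍ A B C D AB CD =
    ∪∩-covers (proj₁ AB) (proj₁ CD) ,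
    tailIn⊎headIn⇒noEdge (A ∪ᵍ C) (B ∩ᵍ D)
      (tailIn⊎headIn-∪ᵍ-∩ᵍ A B C D (oriented⇒tailIn⊎headIn A B AB) (oriented⇒tailIn⊎headIn C D CD))

  oriented⇒dirSep : (A B : Subgraph G) → IsOrientedDirSep A B → IsDirSep A B
  oriented⇒dirSep A B (cover , noEdge) = cover , inj₂ noEdge

  dirSep-sym : (A B : Subgraph G) → IsDirSep A B → IsDirSep B A
  dirSep-sym A B (cover , noEdge) = trans (∪-comm (V B) (V A)) cover , swap noEdge

lemma3p5 : (G : Digraph) (X⁺ X⁻ Y⁺ Y⁻ : Subgraph G)
    → IsOrientedDirSep X⁺ X⁻ → IsOrientedDirSep Y⁺ Y⁻
    → let T  = X⁺ ∩ᵍ Y⁺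
          B  = X⁻ ∩ᵍ Y⁻
          T̄  = X⁻ ∪ᵍ Y⁻
          B̄  = X⁺ ∪ᵍ Y⁺
          St = (sep X⁺ X⁻ ∪ sep Y⁺ Y⁻) ∩ V T
          Sl = (sep X⁺ X⁻ ∪ sep Y⁺ Y⁻) ∩ V B
      in (IsDirSep T T̄ × sep T T̄ ≡ St
            × Uncrossed X⁺ X⁻ T T̄ × Uncrossed Y⁺ Y⁻ T T̄)
         × (IsDirSep B B̄ × sep B B̄ ≡ Sl
            × Uncrossed X⁺ X⁻ B B̄ × Uncrossed Y⁺ Y⁻ B B̄)
         × (∣ Sl ∣ + ∣ St ∣ ≡ ∣ sep X⁺ X⁻ ∣ + ∣ sep Y⁺ Y⁻ ∣)
         × (∣ Sl ∣ ⊓ ∣ St ∣ ≤ ∣ sep X⁺ X⁻ ∣ ⊔ ∣ sep Y⁺ Y⁻ ∣)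
         × ((k : ℕ) → ∣ sep X⁺ X⁻ ∣ ≡ k → ∣ sep Y⁺ Y⁻ ∣ ≡ k
            → (∣ Sl ∣ ≤ k) ⊎ (∣ St ∣ ≤ k))
lemma3p5 G X⁺ X⁻ Y⁺ Y⁻ X Y =
  ( ( oriented⇒dirSep T T̄ (oriented-∩ᵍ-∪ᵍ X⁺ X⁻ Y⁺ Y⁻ X Y) , sep-∩ᵍ-∪ᵍ X⁺ X⁻ Y⁺ Y⁻
    , inj₁ (A∩ᵍB⊑A X⁺ Y⁺ , A⊑A∪ᵍB X⁻ Y⁻) , inj₁ (A∩ᵍB⊑B X⁺ Y⁺ , B⊑A∪ᵍB X⁻ Y⁻))
  , ( dirSep-sym B̄ B (oriented⇒dirSep B̄ B (oriented-∪ᵍ-∩ᵍ X⁺ X⁻ Y⁺ Y⁻ X Y)) , sepB≡Sl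
    , inj₂ (A∩ᵍB⊑A X⁻ Y⁻ , A⊑A∪ᵍB X⁺ Y⁺) , inj₂ (A∩ᵍB⊑B X⁻ Y⁻ , B⊑A∪ᵍB X⁺ Y⁺))
  , sizes , min≤max , one≤k )
  where
  T B T̄ B̄ : Subgraph G
  T = X⁺ ∩ᵍ Y⁺
  B = X⁻ ∩ᵍ Y⁻
  T̄ = X⁻ ∪ᵍ Y⁻
  B̄ = X⁺ ∪ᵍ Y⁺

  S Sl St : Subset (n G)
  S  = sep X⁺ X⁻ ∪ sep Y⁺ Y⁻
  Sl = S ∩ V (X⁻ ∩ᵍ Y⁻)
  St = S ∩ V (X⁺ ∩ᵍ Y⁺)

  sepB≡Sl : sep (X⁻ ∩ᵍ Y⁻) (X⁺ ∪ᵍ Y⁺) ≡ Sl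
  sepB≡Sl = trans (sep-∩ᵍ-∪ᵍ X⁻ X⁺ Y⁻ Y⁺)
                  (cong (_∩ V (X⁻ ∩ᵍ Y⁻)) (cong₂ _∪_ (sep-comm X⁻ X⁺) (sep-comm Y⁻ Y⁺)))

  sizes : ∣ Sl ∣ + ∣ St ∣ ≡ ∣ sep X⁺ X⁻ ∣ + ∣ sep Y⁺ Y⁻ ∣
  sizes = ∣S∩q∩s∣+∣S∩p∩r∣≡∣p∩q∣+∣r∩s∣ (V X⁺) (V X⁻) (V Y⁺) (V Y⁻) (proj₁ X) (proj₁ Y)

  min≤max : ∣ Sl ∣ ⊓ ∣ St ∣ ≤ ∣ sep X⁺ X⁻ ∣ ⊔ ∣ sep Y⁺ Y⁻ ∣
  min≤max = m+n≡o+p⇒m⊓n≤o⊔p (∣ Sl ∣) (∣ St ∣) (∣ sep X⁺ X⁻ ∣) (∣ sep Y⁺ Y⁻ ∣) sizes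

  one≤k : (k : ℕ) → ∣ sep X⁺ X⁻ ∣ ≡ k → ∣ sep Y⁺ Y⁻ ∣ ≡ k → ∣ Sl ∣ ≤ k ⊎ ∣ St ∣ ≤ k
  one≤k k ∣sepX∣≡k ∣sepY∣≡k =
    m⊓n≤o⇒m≤o⊎n≤o (∣ Sl ∣) (∣ St ∣) (≤-trans min≤max (≤-reflexive (trans (cong₂ _⊔_ ∣sepX∣≡k ∣sepY∣≡k) (⊔-idem k))))
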